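{- For all integers $n,k$ with $0\leq k\leq n$, $$\frac{1}{(2n-1)\binom{3n}{n}}\binom{6k}{3k}\binom{3k}{k}\binom{6(n-k)}{3(n-k)}\binom{3(n-k)}{n-k}\in\mathbb{Z}.$$ -}

module Defs where

module Submission where

-- For 0 ≤ k ≤ n put m = n − k and o = 2n − 1.  Writing every binomial coefficient through
-- factorials, the claim  (2n − 1)·C(3n,n) ∣ C(6k,3k)·C(3k,k)·C(6m,3m)·C(3m,m)  becomes
--   o · (3n)!·(3k)!·k!·(2k)!·(3m)!·m!·(2m)!   ∣   (6k)!·(6m)!·n!·(2n)!,
-- which is proved prime by prime by comparing p-adic valuations ν_p.
-- By Legendre's formula ν_p(N!) = Σ_i ⌊N/p^(i+1)⌋, and ν_p(o) counts the levels q = p^(i+1) with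
-- q ∣ o; so it suffices to compare both sides level by level.  For p ≠ 3 the floor inequality
--   ⌊3n/q⌋+⌊3k/q⌋+⌊k/q⌋+⌊2k/q⌋+⌊3m/q⌋+⌊m/q⌋+⌊2m/q⌋ ≤ ⌊6k/q⌋+⌊6m/q⌋+⌊n/q⌋+⌊2n/q⌋
-- holds at every level, strictly when q ∣ o.  All its terms are floors of U = ⌊6k/q⌋, V = ⌊6m/q⌋ and
-- W = ⌊6n/q⌋ ∈ {U+V, U+V+1}, so it reduces to residues modulo 6, which are checked by evaluation.
-- For p = 3 strictness can fail at q = 3; instead ν₃((3N)!) = N + ν₃(N!) cancels most terms and
-- leaves ν₃(o·k!²·m!²) ≤ ν₃((2n)!), which does hold level by level.

open import Defs
open import Data.Nat
open import Data.Nat.Properties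
open import Data.Nat.DivMod
open import Data.Nat.Divisibility renaming (_∣_ to _∣ℕ_)
open import Data.Nat.Combinatorics using (_C_; nCk≡n!/k![n-k]!; k![n∸k]!∣n!)
open import Data.Nat.ListAction using (sum; product)
open import Data.Nat.Primality using (Prime; euclidsLemma; prime⇒nonZero; prime⇒nonTrivial; productOfPrimes≢0)
open import Data.Nat.Primality.Factorisation using (factorise; PrimeFactorisation)
open import Data.Nat.Tactic.RingSolver using (solve-∀)
open import Data.List.Base using (List; []; _∷_; map)
open import Data.List.Relation.Unary.All using (All; []; _∷_)
open import Data.Product using (Σ; _×_; _,_; proj₁; proj₂)
open import Data.Sum using (_⊎_; inj₁; inj₂)
open import Data.Empty using (⊥-elim)
open import Data.Unit using (tt)
open import Function using (_∘_)
open import Relation.Binary.PropositionalEquality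
open import Relation.Nullary using (Dec; yes; no; ¬_)
open import Relation.Nullary.Decidable using (_×-dec_; _→-dec_; toWitness)
open import Algebra.Properties.CommutativeSemigroup +-commutativeSemigroup
  using () renaming (interchange to +-interchange)
open import Algebra.Properties.CommutativeSemigroup *-commutativeSemigroup
  using () renaming (interchange to *-interchange; x∙yz≈y∙xz to *-left-comm)

sumBelow : ℕ → (ℕ → ℕ) → ℕ
sumBelow zero    f = 0
sumBelow (suc Z) f = f 0 + sumBelow Z (f ∘ suc)

sumBelow-cong : ∀ Z {f g : ℕ → ℕ} → (∀ i → f i ≡ g i) → sumBelow Z f ≡ sumBelow Z g
sumBelow-cong zero    f≡g = refl
sumBelow-cong (suc Z) f≡g = cong₂ _+_ (f≡g 0) (sumBelow-cong Z (f≡g ∘ suc))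

sumBelow-mono : ∀ Z {f g : ℕ → ℕ} → (∀ i → f i ≤ g i) → sumBelow Z f ≤ sumBelow Z g
sumBelow-mono zero    f≤g = z≤n
sumBelow-mono (suc Z) f≤g = +-mono-≤ (f≤g 0) (sumBelow-mono Z (f≤g ∘ suc))

sumBelow-+ : ∀ Z (f g : ℕ → ℕ) → sumBelow Z f + sumBelow Z g ≡ sumBelow Z (λ i → f i + g i)
sumBelow-+ zero    f g = refl
sumBelow-+ (suc Z) f g = trans (+-interchange (f 0) _ (g 0) _) (cong (f 0 + g 0 +_) (sumBelow-+ Z (f ∘ suc) (g ∘ suc)))

sumBelow-threshold : ∀ Z a (g : ℕ → ℕ) → a ≤ Z →
  (∀ i → i < a → g i ≡ 1) → (∀ i → a ≤ i → g i ≡ 0) → sumBelow Z g ≡ a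
sumBelow-threshold zero    zero    _ _   _     _     = refl
sumBelow-threshold (suc Z) zero    g _   _     above =
  cong₂ _+_ (above 0 z≤n) (sumBelow-threshold Z 0 (g ∘ suc) z≤n (λ _ ()) (λ i _ → above (suc i) z≤n))
sumBelow-threshold (suc Z) (suc a) g (s≤s a≤Z) below above =
  cong₂ _+_ (below 0 (s≤s z≤n))
    (sumBelow-threshold Z a (g ∘ suc) a≤Z (λ i → below (suc i) ∘ s≤s) (λ i → above (suc i) ∘ s≤s))

indicator : {P : Set} → Dec P → ℕ
indicator (yes _) = 1
indicator (no _)  = 0

indicator-+-≤ : ∀ {P : Set} (P? : Dec P) {L R : ℕ} → L ≤ R → (P → L < R) → indicator P? + L ≤ R
indicator-+-≤ (yes p) _   L<R = L<R p
indicator-+-≤ (no _)  L≤R _   = L≤R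

floor-unique : ∀ x q t .{{_ : NonZero q}} → t * q ≤ x → x < suc t * q → x / q ≡ t
floor-unique x q t lower upper = ≤-antisym
  (m<1+n⇒m≤n (m<n*o⇒m/o<n upper))
  (subst (_≤ x / q) (m*n/n≡m t q) (/-monoˡ-≤ q lower))

floor-upper : ∀ x q .{{_ : NonZero q}} → x < suc (x / q) * q
floor-upper x q = begin-strict
  x                   ≡⟨ m≡m%n+[m/n]*n x q ⟩
  x % q + (x / q) * q <⟨ +-monoˡ-< ((x / q) * q) (m%n<n x q) ⟩
  q + (x / q) * q     ∎
  where open ≤-Reasoning

floor-superadditive : ∀ x y q .{{_ : NonZero q}} → x / q + y / q ≤ (x + y) / q
floor-superadditive x y q = subst (_≤ (x + y) / q) (m*n/n≡m (x / q + y / q) q) (/-monoˡ-≤ q (begin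
  (x / q + y / q) * q     ≡⟨ *-distribʳ-+ q (x / q) (y / q) ⟩
  x / q * q + y / q * q   ≤⟨ +-mono-≤ (m/n*n≤m x q) (m/n*n≤m y q) ⟩
  x + y                   ∎))
  where open ≤-Reasoning

floor-subadditive : ∀ x y q .{{_ : NonZero q}} → (x + y) / q ≤ suc (x / q + y / q)
floor-subadditive x y q = m<1+n⇒m≤n (m<n*o⇒m/o<n (begin-strict
  x + y                               <⟨ +-mono-< (floor-upper x q) (floor-upper y q) ⟩
  suc (x / q) * q + suc (y / q) * q   ≡⟨ *-distribʳ-+ q (suc (x / q)) (suc (y / q)) ⟨
  (suc (x / q) + suc (y / q)) * q     ≡⟨ cong (λ s → suc s * q) (+-suc (x / q) (y / q)) ⟩
  suc (suc (x / q + y / q)) * q       ∎))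
  where open ≤-Reasoning

floor-+-multiple : ∀ x t q .{{_ : NonZero q}} → (x + t * q) / q ≡ x / q + t
floor-+-multiple x t q = trans (+-distrib-/-∣ʳ x (n∣m*n t)) (cong (x / q +_) (m*n/n≡m t q))

floor-nested : ∀ c x q .{{_ : NonZero c}} .{{_ : NonZero q}} → (c * x) / q / c ≡ x / q
floor-nested c x q = begin
  (c * x) / q / c    ≡⟨ m/n/o≡m/[n*o] (c * x) q c ⟩
  (c * x) / (q * c)  ≡⟨ /-congʳ (*-comm q c) ⟩
  (c * x) / (c * q)  ≡⟨ m*n/m*o≡n/o c x q ⟩
  x / q              ∎
  where
  open ≡-Reasoning
  instance
    cq≢0 : NonZero (c * q)
    cq≢0 = m*n≢0 c q
    qc≢0 : NonZero (q * c)
    qc≢0 = m*n≢0 q c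

floor-step : ∀ N q .{{_ : NonZero q}} → suc N / q ≡ N / q + indicator (q ∣? suc N)
floor-step N q with q ∣? suc N
... | no q∤1+N = trans (floor-unique (suc N) q (N / q) lower upper) (sym (+-identityʳ (N / q)))
  where
  lower : N / q * q ≤ suc N
  lower = m≤n⇒m≤1+n (m/n*n≤m N q)
  upper : suc N < suc (N / q) * q
  upper = ≤∧≢⇒< (floor-upper N q) (λ eq → q∤1+N (divides (suc (N / q)) eq))
... | yes (divides zero ())
... | yes (divides (suc t) 1+N≡q+tq) = begin
  suc N / q     ≡⟨ /-congˡ 1+N≡q+tq ⟩
  suc t * q / q ≡⟨ m*n/n≡m (suc t) q ⟩
  suc t         ≡⟨ +-comm 1 t ⟩
  t + 1         ≡⟨ cong (_+ 1) (floor-unique N q t lower upper) ⟨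
  N / q + 1     ∎
  where
  open ≡-Reasoning
  lower : t * q ≤ N
  lower = ≤-pred (subst (suc (t * q) ≤_) (sym 1+N≡q+tq) (+-monoˡ-≤ (t * q) (>-nonZero⁻¹ q)))
  upper : N < suc t * q
  upper = subst (N <_) 1+N≡q+tq ≤-refl

floorSum : ∀ q .{{_ : NonZero q}} → List ℕ → ℕ
floorSum q xs = sum (map (λ x → x / q) xs)

factorials : List ℕ → ℕ
factorials xs = product (map _! xs)

factorials≢0 : ∀ xs → NonZero (factorials xs)
factorials≢0 []       = _
factorials≢0 (x ∷ xs) = m*n≢0 (x !) (factorials xs) {{x !≢0}} {{factorials≢0 xs}}

module Valuation {p : ℕ} (p-prime : Prime p) where

  instance
    p≢0 : NonZero p
    p≢0 = prime⇒nonZero p-prime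

  1<p : 1 < p
  1<p = nonTrivial⇒n>1 p {{prime⇒nonTrivial p-prime}}

  ^-∣ : ∀ {a b} → a ≤ b → p ^ a ∣ℕ p ^ b
  ^-∣ {a} {b} a≤b = divides (p ^ (b ∸ a)) (begin
    p ^ b               ≡⟨ cong (p ^_) (m+[n∸m]≡n a≤b) ⟨
    p ^ (a + (b ∸ a))   ≡⟨ ^-distribˡ-+-* p a (b ∸ a) ⟩
    p ^ a * p ^ (b ∸ a) ≡⟨ *-comm (p ^ a) (p ^ (b ∸ a)) ⟩
    p ^ (b ∸ a) * p ^ a ∎)
    where open ≡-Reasoning

  record ExactPower (a x : ℕ) : Set where
    constructor exact
    field
      power-∣      : p ^ a ∣ℕ x
      next-power-∤ : ¬ (p ^ suc a ∣ℕ x)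

  exact-maximal : ∀ {a x e} → ExactPower a x → p ^ e ∣ℕ x → e ≤ a
  exact-maximal {a} {x} {e} (exact _ p^1+a∤x) p^e∣x with e ≤? a
  ... | yes e≤a = e≤a
  ... | no  e≰a = ⊥-elim (p^1+a∤x (∣-trans (^-∣ (≰⇒> e≰a)) p^e∣x))

  exact-unique : ∀ {a b x} → ExactPower a x → ExactPower b x → a ≡ b
  exact-unique ea eb = ≤-antisym (exact-maximal eb (ExactPower.power-∣ ea)) (exact-maximal ea (ExactPower.power-∣ eb))

  exact-cofactor : ∀ {a w} → ¬ (p ∣ℕ w) → ExactPower a (w * p ^ a)
  exact-cofactor {a} {w} p∤w = exact (n∣m*n w) λ p·p^a∣w·p^a → p∤w (*-cancelʳ-∣ (p ^ a) {{m^n≢0 p a}} p·p^a∣w·p^a)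

  cofactor-coprime : ∀ {a w} → ¬ (p ^ suc a ∣ℕ w * p ^ a) → ¬ (p ∣ℕ w)
  cofactor-coprime {a} p^1+a∤w·p^a p∣w = p^1+a∤w·p^a (*-monoˡ-∣ (p ^ a) p∣w)

  -- Exact powers multiply (this is where primality of p enters, via Euclid's lemma).
  exact-* : ∀ {a b x y} → ExactPower a x → ExactPower b y → ExactPower (a + b) (x * y)
  exact-* {a} {b} (exact (divides-refl w) p^1+a∤x) (exact (divides-refl z) p^1+b∤y) =
    subst (ExactPower (a + b)) (sym xy≡wz·p^a+b) (exact-cofactor {a + b} p∤wz)
    where
    p∤wz : ¬ (p ∣ℕ w * z)
    p∤wz p∣wz with euclidsLemma w z p-prime p∣wz
    ... | inj₁ p∣w = cofactor-coprime {a} p^1+a∤x p∣w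
    ... | inj₂ p∣z = cofactor-coprime {b} p^1+b∤y p∣z
    xy≡wz·p^a+b : (w * p ^ a) * (z * p ^ b) ≡ (w * z) * p ^ (a + b)
    xy≡wz·p^a+b = trans (*-interchange w (p ^ a) z (p ^ b)) (cong (w * z *_) (sym (^-distribˡ-+-* p a b)))

  p-exact : ExactPower 1 p
  p-exact = exact (subst (_∣ℕ p) (sym (*-identityʳ p)) ∣-refl) λ p²∣p → <⇒≱ p<p² (∣⇒≤ p²∣p)
    where
    p<p² : p < p * (p * 1)
    p<p² = subst (λ s → p < p * s) (sym (*-identityʳ p)) (m<m*n p p 1<p)

  one-exact : ExactPower 0 1
  one-exact = exact (1∣ 1) λ p∣1 → <⇒≱ (subst (1 <_) (sym (*-identityʳ p)) 1<p) (∣⇒≤ p∣1)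

  -- The valuation, computed by dividing out p; the fuel f only has to exceed x.
  valFuel : ℕ → ℕ → ℕ
  valFuel zero    x = 0
  valFuel (suc f) x with p ∣? x
  ... | yes _ = suc (valFuel f (x / p))
  ... | no  _ = 0

  val : ℕ → ℕ
  val x = valFuel x x

  valFuel-exact : ∀ f x .{{_ : NonZero x}} → x ≤ f → ExactPower (valFuel f x) x
  valFuel-exact zero    (suc x) ()
  valFuel-exact (suc f) x x≤1+f with p ∣? x
  ... | no  p∤x = exact (1∣ x) λ p^1∣x → p∤x (subst (_∣ℕ x) (*-identityʳ p) p^1∣x)
  ... | yes p∣x = subst (ExactPower (suc (valFuel f y))) p·y≡x (exact-* p-exact (valFuel-exact f y y≤f))
    where
    y : ℕ
    y = x / p
    p·y≡x : p * y ≡ x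
    p·y≡x = m*[n/m]≡n p∣x
    instance
      y≢0 : NonZero y
      y≢0 = ≢-nonZero (λ y≡0 → ≢-nonZero⁻¹ x (trans (sym p·y≡x) (trans (cong (p *_) y≡0) (*-zeroʳ p))))
    y≤f : y ≤ f
    y≤f = ≤-pred (≤-trans (m/n<m x p 1<p) x≤1+f)

  val-exact : ∀ x .{{_ : NonZero x}} → ExactPower (val x) x
  val-exact x = valFuel-exact x x ≤-refl

  val-* : ∀ x y .{{_ : NonZero x}} .{{_ : NonZero y}} → val (x * y) ≡ val x + val y
  val-* x y = exact-unique (val-exact (x * y) {{m*n≢0 x y}}) (exact-* (val-exact x) (val-exact y))

  val-1 : val 1 ≡ 0
  val-1 = exact-unique (val-exact 1) one-exact

  val-p : val p ≡ 1
  val-p = exact-unique (val-exact p) p-exact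

  positive-val⇒∣ : ∀ x .{{_ : NonZero x}} → 0 < val x → p ∣ℕ x
  positive-val⇒∣ x 0<val = subst (_∣ℕ x) (*-identityʳ p) (∣-trans (^-∣ 0<val) (ExactPower.power-∣ (val-exact x)))

  -- a ≤ p^a, so that x ≤ Z levels suffice to see all of ν(x).
  a≤p^a : ∀ a → a ≤ p ^ a
  a≤p^a zero    = z≤n
  a≤p^a (suc a) = begin
    suc a           ≤⟨ s≤s (a≤p^a a) ⟩
    1 + p ^ a       ≤⟨ +-monoˡ-≤ (p ^ a) (>-nonZero⁻¹ (p ^ a) {{m^n≢0 p a}}) ⟩
    p ^ a + p ^ a   ≡⟨ cong (p ^ a +_) (+-identityʳ (p ^ a)) ⟨
    2 * p ^ a       ≤⟨ *-monoˡ-≤ (p ^ a) 1<p ⟩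
    p * p ^ a       ∎
    where open ≤-Reasoning

  val-levels : ∀ Z x .{{_ : NonZero x}} → x ≤ Z → val x ≡ sumBelow Z (λ i → indicator (p ^ suc i ∣? x))
  val-levels Z x x≤Z = sym (sumBelow-threshold Z (val x) _ val≤Z below above)
    where
    open ExactPower (val-exact x)
    val≤Z : val x ≤ Z
    val≤Z = ≤-trans (a≤p^a (val x)) (≤-trans (∣⇒≤ power-∣) x≤Z)
    below : ∀ i → i < val x → indicator (p ^ suc i ∣? x) ≡ 1
    below i i<val with p ^ suc i ∣? x
    ... | yes _    = refl
    ... | no  p^∤x = ⊥-elim (p^∤x (∣-trans (^-∣ i<val) power-∣))
    above : ∀ i → val x ≤ i → indicator (p ^ suc i ∣? x) ≡ 0
    above i val≤i with p ^ suc i ∣? x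
    ... | yes p^∣x = ⊥-elim (<⇒≱ (exact-maximal (val-exact x) p^∣x) val≤i)
    ... | no  _    = refl

  _/p^_ : ℕ → ℕ → ℕ
  x /p^ i = (x / p ^ i) {{m^n≢0 p i}}

  legendre : ∀ Z N → N ≤ Z → val (N !) ≡ sumBelow Z (λ i → N /p^ suc i)
  legendre Z zero    _     = trans val-1 (sym (sumBelow-threshold Z 0 _ z≤n (λ _ ()) (λ i _ → 0/n≡0 (p ^ suc i) {{m^n≢0 p (suc i)}})))
  legendre Z (suc N) 1+N≤Z = begin
    val (suc N * N !)                     ≡⟨ val-* (suc N) (N !) {{_}} {{N !≢0}} ⟩
    val (suc N) + val (N !)               ≡⟨ +-comm (val (suc N)) (val (N !)) ⟩
    val (N !) + val (suc N)               ≡⟨ cong₂ _+_ (legendre Z N (<⇒≤ 1+N≤Z)) (val-levels Z (suc N) 1+N≤Z) ⟩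
    sumBelow Z (λ i → N /p^ suc i) + sumBelow Z (λ i → indicator (p ^ suc i ∣? suc N))
                                          ≡⟨ sumBelow-+ Z _ _ ⟩
    sumBelow Z (λ i → N /p^ suc i + indicator (p ^ suc i ∣? suc N))
                                          ≡⟨ sumBelow-cong Z (λ i → floor-step N (p ^ suc i) {{m^n≢0 p (suc i)}}) ⟨
    sumBelow Z (λ i → suc N /p^ suc i)    ∎
    where open ≡-Reasoning

  legendre-factorials : ∀ Z xs → All (_≤ Z) xs → val (factorials xs) ≡ sumBelow Z (λ i → floorSum (p ^ suc i) {{m^n≢0 p (suc i)}} xs)
  legendre-factorials Z []       []           = trans val-1 (sym (sumBelow-threshold Z 0 _ z≤n (λ _ ()) (λ _ _ → refl)))
  legendre-factorials Z (x ∷ xs) (x≤Z ∷ xs≤Z) = begin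
    val (x ! * factorials xs)            ≡⟨ val-* (x !) (factorials xs) {{x !≢0}} {{factorials≢0 xs}} ⟩
    val (x !) + val (factorials xs)      ≡⟨ cong₂ _+_ (legendre Z x x≤Z) (legendre-factorials Z xs xs≤Z) ⟩
    _                                    ≡⟨ sumBelow-+ Z _ _ ⟩
    sumBelow Z (λ i → floorSum (p ^ suc i) {{m^n≢0 p (suc i)}} (x ∷ xs)) ∎
    where open ≡-Reasoning

  val-≤-by-levels : ∀ Z o xs ys .{{_ : NonZero o}} → o ≤ Z → All (_≤ Z) xs → All (_≤ Z) ys →
    (∀ i → let instance _ = m^n≢0 p (suc i) in indicator (p ^ suc i ∣? o) + floorSum (p ^ suc i) xs ≤ floorSum (p ^ suc i) ys) →
    val (o * factorials xs) ≤ val (factorials ys)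
  val-≤-by-levels Z o xs ys {{o≢0}} o≤Z xs≤Z ys≤Z levels = begin
    val (o * factorials xs)            ≡⟨ val-* o (factorials xs) {{o≢0}} {{factorials≢0 xs}} ⟩
    val o + val (factorials xs)        ≡⟨ cong₂ _+_ (val-levels Z o o≤Z) (legendre-factorials Z xs xs≤Z) ⟩
    _                                  ≡⟨ sumBelow-+ Z _ _ ⟩
    _                                  ≤⟨ sumBelow-mono Z levels ⟩
    _                                  ≡⟨ legendre-factorials Z ys ys≤Z ⟨
    val (factorials ys)                ∎
    where open ≤-Reasoning

  -- ν((pN)!) = N + ν(N!): the first Legendre level contributes N, the others are those of N!.
  val-multiple! : ∀ N → val ((p * N) !) ≡ N + val (N !)
  val-multiple! N = begin
    val ((p * N) !)                                       ≡⟨ legendre (suc (p * N)) (p * N) (n≤1+n (p * N)) ⟩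
    (p * N) /p^ 1 + sumBelow (p * N) (λ i → (p * N) /p^ suc (suc i))
      ≡⟨ cong₂ _+_ first-level (sumBelow-cong (p * N) other-levels) ⟩
    N + sumBelow (p * N) (λ i → N /p^ suc i)              ≡⟨ cong (N +_) (legendre (p * N) N (m≤n*m N p)) ⟨
    N + val (N !)                                         ∎
    where
    open ≡-Reasoning
    first-level : (p * N) /p^ 1 ≡ N
    first-level = trans (m*n/m*o≡n/o p N 1 {{_}} {{m^n≢0 p 1}}) (n/1≡n N)
    other-levels : ∀ i → (p * N) /p^ suc (suc i) ≡ N /p^ suc i
    other-levels i = m*n/m*o≡n/o p N (p ^ suc i) {{m^n≢0 p (suc i)}} {{m^n≢0 p (suc (suc i))}}

  val-factorials : ∀ xs → val (factorials xs) ≡ sum (map (λ x → val (x !)) xs)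
  val-factorials []       = val-1
  val-factorials (x ∷ xs) = trans (val-* (x !) (factorials xs) {{x !≢0}} {{factorials≢0 xs}}) (cong (val (x !) +_) (val-factorials xs))

open Valuation using (val; val-*)

product-∣ : ∀ qs → All Prime qs → ∀ B .{{_ : NonZero B}} →
  (∀ {r} (r-prime : Prime r) → val r-prime (product qs) ≤ val r-prime B) → product qs ∣ℕ B
product-∣ []       []                  B vals≤ = 1∣ B
product-∣ (q ∷ qs) (q-prime ∷ qs-prime) B vals≤ =
  subst (q * product qs ∣ℕ_) (sym B≡q·B') (*-monoʳ-∣ q (product-∣ qs qs-prime B' vals'≤))
  where
  instance
    q≢0 : NonZero q
    q≢0 = prime⇒nonZero q-prime
    qs≢0 : NonZero (product qs)
    qs≢0 = productOfPrimes≢0 qs-prime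
  0<val : 0 < val q-prime (q * product qs)
  0<val = subst (0 <_) (sym (trans (val-* q-prime q (product qs)) (cong (_+ val q-prime (product qs)) (Valuation.val-p q-prime)))) (s≤s z≤n)
  q∣B : q ∣ℕ B
  q∣B = Valuation.positive-val⇒∣ q-prime B (<-≤-trans 0<val (vals≤ q-prime))
  B' : ℕ
  B' = quotient q∣B
  B≡q·B' : B ≡ q * B'
  B≡q·B' = m∣n⇒n≡m*quotient q∣B
  instance
    B'≢0 : NonZero B'
    B'≢0 = quotient≢0 q∣B
  vals'≤ : ∀ {r} (r-prime : Prime r) → val r-prime (product qs) ≤ val r-prime B'
  vals'≤ r-prime = +-cancelˡ-≤ (val r-prime q) _ _ (subst₂ _≤_
    (val-* r-prime q (product qs)) (trans (cong (val r-prime) B≡q·B') (val-* r-prime q B')) (vals≤ r-prime))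

∣-from-valuations : ∀ A B .{{_ : NonZero A}} .{{_ : NonZero B}} →
  (∀ {p} (p-prime : Prime p) → val p-prime A ≤ val p-prime B) → A ∣ℕ B
∣-from-valuations A B vals≤ = subst (_∣ℕ B) (sym A≡∏)
  (product-∣ factors factorsPrime B (λ p-prime → subst (λ a → val p-prime a ≤ val p-prime B) A≡∏ (vals≤ p-prime)))
  where
  f : PrimeFactorisation A
  f = factorise A
  open PrimeFactorisation f using (factors; factorsPrime) renaming (isFactorisation to A≡∏)

-- Both sides of the floor inequality, written through U = ⌊6k/q⌋, V = ⌊6m/q⌋ and W = ⌊6(k+m)/q⌋.
denFloors : ℕ → ℕ → ℕ → ℕ
denFloors U V W = W / 2 + (U / 2 + (U / 6 + (U / 3 + (V / 2 + (V / 6 + (V / 3 + 0))))))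

numFloors : ℕ → ℕ → ℕ → ℕ
numFloors U V W = U + (V + (W / 6 + (W / 3 + 0)))

FloorBound : ℕ → ℕ → ℕ → Set
FloorBound U V W = denFloors U V W ≤ numFloors U V W × (W % 6 ≡ 3 → denFloors U V W < numFloors U V W)

floorBound? : ∀ U V W → Dec (FloorBound U V W)
floorBound? U V W = denFloors U V W ≤? numFloors U V W ×-dec (W % 6 ≟ 3 →-dec denFloors U V W <? numFloors U V W)

floorBound-residues : ∀ {a} → a < 6 → ∀ {b} → b < 6 → ∀ {e} → e < 2 → FloorBound a b (a + b + e)
floorBound-residues = toWitness {a? = allUpTo? (λ a → allUpTo? (λ b → allUpTo? (λ e → floorBound? a b (a + b + e)) 2) 6) 6} tt

floor-+-6multiple : ∀ x s d e .{{_ : NonZero d}} → e * d ≡ 6 → (x + s * 6) / d ≡ x / d + s * e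
floor-+-6multiple x s d e e·d≡6 = trans (/-congˡ (cong (x +_) s·6≡s·e·d)) (floor-+-multiple x (s * e) d)
  where
  s·6≡s·e·d : s * 6 ≡ s * e * d
  s·6≡s·e·d = trans (cong (s *_) (sym e·d≡6)) (sym (*-assoc s e d))

denFloors-shift : ∀ a b c u v → denFloors (a + u * 6) (b + v * 6) (c + (u + v) * 6) ≡ denFloors a b c + (u + v) * 9
denFloors-shift a b c u v = begin
  denFloors (a + u * 6) (b + v * 6) (c + (u + v) * 6)
    ≡⟨ cong₂ _+_ (floor-+-6multiple c (u + v) 2 3 refl)
       (cong₂ _+_ (floor-+-6multiple a u 2 3 refl) (cong₂ _+_ (floor-+-6multiple a u 6 1 refl)
       (cong₂ _+_ (floor-+-6multiple a u 3 2 refl) (cong₂ _+_ (floor-+-6multiple b v 2 3 refl)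
       (cong₂ _+_ (floor-+-6multiple b v 6 1 refl) (cong (_+ 0) (floor-+-6multiple b v 3 2 refl))))))) ⟩
  (c / 2 + (u + v) * 3) + ((a / 2 + u * 3) + ((a / 6 + u * 1) + ((a / 3 + u * 2)
    + ((b / 2 + v * 3) + ((b / 6 + v * 1) + ((b / 3 + v * 2) + 0))))))
    ≡⟨ regroup (c / 2) (a / 2) (a / 6) (a / 3) (b / 2) (b / 6) (b / 3) u v ⟩
  denFloors a b c + (u + v) * 9 ∎
  where
  open ≡-Reasoning
  regroup : ∀ c₂ a₂ a₆ a₃ b₂ b₆ b₃ u v →
    (c₂ + (u + v) * 3) + ((a₂ + u * 3) + ((a₆ + u * 1) + ((a₃ + u * 2)
      + ((b₂ + v * 3) + ((b₆ + v * 1) + ((b₃ + v * 2) + 0))))))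
    ≡ (c₂ + (a₂ + (a₆ + (a₃ + (b₂ + (b₆ + (b₃ + 0))))))) + (u + v) * 9
  regroup = solve-∀

numFloors-shift : ∀ a b c u v → numFloors (a + u * 6) (b + v * 6) (c + (u + v) * 6) ≡ numFloors a b c + (u + v) * 9
numFloors-shift a b c u v = begin
  numFloors (a + u * 6) (b + v * 6) (c + (u + v) * 6)
    ≡⟨ cong (λ s → a + u * 6 + (b + v * 6 + s))
         (cong₂ _+_ (floor-+-6multiple c (u + v) 6 1 refl) (cong (_+ 0) (floor-+-6multiple c (u + v) 3 2 refl))) ⟩
  (a + u * 6) + ((b + v * 6) + ((c / 6 + (u + v) * 1) + ((c / 3 + (u + v) * 2) + 0)))
    ≡⟨ regroup a b (c / 6) (c / 3) u v ⟩
  numFloors a b c + (u + v) * 9 ∎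
  where
  open ≡-Reasoning
  regroup : ∀ a b c₆ c₃ u v →
    (a + u * 6) + ((b + v * 6) + ((c₆ + (u + v) * 1) + ((c₃ + (u + v) * 2) + 0)))
    ≡ (a + (b + (c₆ + (c₃ + 0)))) + (u + v) * 9
  regroup = solve-∀

floorBound-shift : ∀ a b c u v → FloorBound a b c → FloorBound (a + u * 6) (b + v * 6) (c + (u + v) * 6)
floorBound-shift a b c u v (den≤num , den<num) =
  subst₂ _≤_ (sym (denFloors-shift a b c u v)) (sym (numFloors-shift a b c u v)) (+-monoˡ-≤ ((u + v) * 9) den≤num) ,
  λ c+6s%6≡3 → subst₂ _<_ (sym (denFloors-shift a b c u v)) (sym (numFloors-shift a b c u v))
                 (+-monoˡ-< ((u + v) * 9) (den<num (trans (sym ([m+kn]%n≡m%n c (u + v) 6)) c+6s%6≡3)))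

floorBound : ∀ U V e → e < 2 → FloorBound U V (U + V + e)
floorBound U V e e<2 = subst₂ (λ U′ V′ → FloorBound U′ V′ (U′ + V′ + e)) (sym U≡) (sym V≡)
  (subst (FloorBound (a + u * 6) (b + v * 6)) (regroup a b e u v)
    (floorBound-shift a b (a + b + e) u v (floorBound-residues (m%n<n U 6) (m%n<n V 6) e<2)))
  where
  a b u v : ℕ
  a = U % 6
  b = V % 6
  u = U / 6
  v = V / 6
  U≡ : U ≡ a + u * 6
  U≡ = m≡m%n+[m/n]*n U 6
  V≡ : V ≡ b + v * 6
  V≡ = m≡m%n+[m/n]*n V 6
  regroup : ∀ a b e u v → a + b + e + (u + v) * 6 ≡ a + u * 6 + (b + v * 6) + e
  regroup = solve-∀

-- The factorial arguments of the denominator and numerator of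
--   C(6k,3k)·C(3k,k)·C(6m,3m)·C(3m,m) / C(3n,n)  with n = k + m.
denArgs : ℕ → ℕ → List ℕ
denArgs k m = 3 * (k + m) ∷ 3 * k ∷ k ∷ 2 * k ∷ 3 * m ∷ m ∷ 2 * m ∷ []

numArgs : ℕ → ℕ → List ℕ
numArgs k m = 6 * k ∷ 6 * m ∷ k + m ∷ 2 * (k + m) ∷ []

floor-via-6x : ∀ c d x q .{{_ : NonZero d}} .{{_ : NonZero q}} → d * c ≡ 6 → (6 * x) / q / d ≡ (c * x) / q
floor-via-6x c d x q d·c≡6 = trans (cong (λ y → y / q / d) 6x≡d·cx) (floor-nested d (c * x) q)
  where
  6x≡d·cx : 6 * x ≡ d * (c * x)
  6x≡d·cx = trans (cong (_* x) (sym d·c≡6)) (*-assoc d c x)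

-- At a fixed level q the two floor sums are denFloors and numFloors of U = ⌊6k/q⌋, V = ⌊6m/q⌋,
-- W = ⌊6(k+m)/q⌋, and W = U + V + carry with carry ∈ {0, 1}; so FloorBound U V W holds.
module _ (q : ℕ) .{{_ : NonZero q}} (k m : ℕ) where
  private
    U V W : ℕ
    U = (6 * k) / q
    V = (6 * m) / q
    W = (6 * (k + m)) / q

  floorSum-denArgs : floorSum q (denArgs k m) ≡ denFloors U V W
  floorSum-denArgs = sym (cong₂ _+_ (floor-via-6x 3 2 (k + m) q refl)
    (cong₂ _+_ (floor-via-6x 3 2 k q refl) (cong₂ _+_ (floor-nested 6 k q) (cong₂ _+_ (floor-via-6x 2 3 k q refl)
    (cong₂ _+_ (floor-via-6x 3 2 m q refl) (cong₂ _+_ (floor-nested 6 m q) (cong (_+ 0) (floor-via-6x 2 3 m q refl))))))))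

  floorSum-numArgs : floorSum q (numArgs k m) ≡ numFloors U V W
  floorSum-numArgs = sym (cong (λ s → U + (V + s))
    (cong₂ _+_ (floor-nested 6 (k + m) q) (cong (_+ 0) (floor-via-6x 2 3 (k + m) q refl))))

  W≡U+V+carry : W ≡ U + V + (W ∸ (U + V))
  W≡U+V+carry = sym (m+[n∸m]≡n U+V≤W)
    where
    U+V≤W : U + V ≤ W
    U+V≤W = subst (λ x → U + V ≤ x / q) (sym (*-distribˡ-+ 6 k m)) (floor-superadditive (6 * k) (6 * m) q)

  carry<2 : W ∸ (U + V) < 2
  carry<2 = s≤s (m≤n+o⇒m∸n≤o W (U + V) (subst (W ≤_) (+-comm 1 (U + V)) W≤1+U+V))
    where
    W≤1+U+V : W ≤ suc (U + V)
    W≤1+U+V = subst (λ x → x / q ≤ suc (U + V)) (sym (*-distribˡ-+ 6 k m)) (floor-subadditive (6 * k) (6 * m) q)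

  floorBound-at : FloorBound U V W
  floorBound-at = subst (FloorBound U V) (sym W≡U+V+carry) (floorBound U V (W ∸ (U + V)) carry<2)

even-or-odd : ∀ t → Σ ℕ λ j → t ≡ 2 * j ⊎ t ≡ suc (2 * j)
even-or-odd zero    = 0 , inj₁ refl
even-or-odd (suc t) with even-or-odd t
... | j , inj₁ t≡2j   = j , inj₂ (cong suc t≡2j)
... | j , inj₂ t≡1+2j = suc j , inj₁ (trans (cong suc t≡1+2j) (sym (*-suc 2 j)))

odd-cofactor : ∀ {q o n} → q ∣ℕ o → suc o ≡ 2 * n → Σ ℕ λ j → o ≡ suc (2 * j) * q
odd-cofactor {q} {o} {n} (divides t o≡tq) 1+o≡2n with even-or-odd t
... | j , inj₂ t≡1+2j = j , trans o≡tq (cong (_* q) t≡1+2j)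
... | j , inj₁ t≡2j   = ⊥-elim (even≢odd n (j * q) (begin
  2 * n            ≡⟨ 1+o≡2n ⟨
  suc o            ≡⟨ cong suc (trans o≡tq (cong (_* q) t≡2j)) ⟩
  suc (2 * j * q)  ≡⟨ cong suc (*-assoc 2 j q) ⟩
  suc (2 * (j * q)) ∎))
  where open ≡-Reasoning

twice-floor≤ : ∀ n q .{{_ : NonZero q}} → n / q + n / q ≤ (2 * n) / q
twice-floor≤ n q = subst (λ x → n / q + n / q ≤ (n + x) / q) (sym (+-identityʳ n)) (floor-superadditive n n q)

-- If q ≥ 2 divides the odd number 2n − 1, then 2⌊n/q⌋ < ⌊2n/q⌋, because ⌊2n/q⌋ = (2n−1)/q is odd.
twice-floor< : ∀ {q o n} .{{_ : NonZero q}} → 2 ≤ q → q ∣ℕ o → suc o ≡ 2 * n → n / q + n / q < (2 * n) / q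
twice-floor< {q} {o} {n} 2≤q q∣o 1+o≡2n with odd-cofactor {q} {o} {n} q∣o 1+o≡2n
... | j , o≡odd·q = ≤∧≢⇒< (twice-floor≤ n q) twice≢
  where
  2n/q≡1+2j : (2 * n) / q ≡ suc (2 * j)
  2n/q≡1+2j = begin
    (2 * n) / q               ≡⟨ /-congˡ (trans (sym 1+o≡2n) (cong suc o≡odd·q)) ⟩
    (1 + suc (2 * j) * q) / q ≡⟨ floor-+-multiple 1 (suc (2 * j)) q ⟩
    1 / q + suc (2 * j)       ≡⟨ cong (_+ suc (2 * j)) (m<n⇒m/n≡0 2≤q) ⟩
    suc (2 * j)               ∎
    where open ≡-Reasoning
  twice≢ : n / q + n / q ≢ (2 * n) / q
  twice≢ eq = even≢odd (n / q) j (trans (cong (n / q +_) (+-identityʳ (n / q))) (trans eq 2n/q≡1+2j))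

-- If q ≥ 4 divides the odd number 2n − 1, then ⌊6n/q⌋ = 3(2n−1)/q ≡ 3 (mod 6).
sixfold-floor-mod6 : ∀ {q o n} .{{_ : NonZero q}} → 4 ≤ q → q ∣ℕ o → suc o ≡ 2 * n → (6 * n) / q % 6 ≡ 3
sixfold-floor-mod6 {q} {o} {n} 4≤q q∣o 1+o≡2n with odd-cofactor {q} {o} {n} q∣o 1+o≡2n
... | j , o≡odd·q = begin
  (6 * n) / q % 6                     ≡⟨ cong (_% 6) (/-congˡ 6n≡3+tq) ⟩
  (3 + 3 * suc (2 * j) * q) / q % 6   ≡⟨ cong (_% 6) (floor-+-multiple 3 (3 * suc (2 * j)) q) ⟩
  (3 / q + 3 * suc (2 * j)) % 6       ≡⟨ cong (λ x → (x + 3 * suc (2 * j)) % 6) (m<n⇒m/n≡0 4≤q) ⟩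
  3 * suc (2 * j) % 6                 ≡⟨ cong (_% 6) (3·odd j) ⟩
  (3 + j * 6) % 6                     ≡⟨ [m+kn]%n≡m%n 3 j 6 ⟩
  3                                   ∎
  where
  open ≡-Reasoning
  6n≡3+tq : 6 * n ≡ 3 + 3 * suc (2 * j) * q
  6n≡3+tq = begin
    6 * n                     ≡⟨ *-assoc 3 2 n ⟩
    3 * (2 * n)               ≡⟨ cong (3 *_) (trans (sym 1+o≡2n) (cong suc o≡odd·q)) ⟩
    3 * suc (suc (2 * j) * q) ≡⟨ *-suc 3 (suc (2 * j) * q) ⟩
    3 + 3 * (suc (2 * j) * q) ≡⟨ cong (3 +_) (*-assoc 3 (suc (2 * j)) q) ⟨
    3 + 3 * suc (2 * j) * q   ∎
  3·odd : ∀ j → 3 * suc (2 * j) ≡ 3 + j * 6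
  3·odd = solve-∀

level-≤ : ∀ q .{{_ : NonZero q}} k m → floorSum q (denArgs k m) ≤ floorSum q (numArgs k m)
level-≤ q k m = subst₂ _≤_ (sym (floorSum-denArgs q k m)) (sym (floorSum-numArgs q k m)) (proj₁ (floorBound-at q k m))

level-< : ∀ q .{{_ : NonZero q}} k m {o} → 4 ≤ q → q ∣ℕ o → suc o ≡ 2 * (k + m) →
  floorSum q (denArgs k m) < floorSum q (numArgs k m)
level-< q k m 4≤q q∣o 1+o≡2n = subst₂ _<_ (sym (floorSum-denArgs q k m)) (sym (floorSum-numArgs q k m))
  (proj₂ (floorBound-at q k m) (sixfold-floor-mod6 {n = k + m} 4≤q q∣o 1+o≡2n))

-- For p = 3 only the inequality 2⌊k/q⌋ + 2⌊m/q⌋ ≤ ⌊2n/q⌋ is needed (see MainInequality below):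
-- it compares k!²·m!² with (2n)!, and is strict when q ≥ 2 divides 2n − 1.
denArgs₃ : ℕ → ℕ → List ℕ
denArgs₃ k m = k ∷ k ∷ m ∷ m ∷ []

numArgs₃ : ℕ → ℕ → List ℕ
numArgs₃ k m = 2 * (k + m) ∷ []

level₃-≤twice : ∀ q .{{_ : NonZero q}} k m → floorSum q (denArgs₃ k m) ≤ (k + m) / q + (k + m) / q
level₃-≤twice q k m = subst (_≤ (k + m) / q + (k + m) / q) (sym (regroup (k / q) (m / q)))
  (+-mono-≤ (floor-superadditive k m q) (floor-superadditive k m q))
  where
  regroup : ∀ a b → a + (a + (b + (b + 0))) ≡ (a + b) + (a + b)
  regroup = solve-∀

level₃-≤ : ∀ q .{{_ : NonZero q}} k m → floorSum q (denArgs₃ k m) ≤ floorSum q (numArgs₃ k m)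
level₃-≤ q k m = ≤-trans (level₃-≤twice q k m) (≤-trans (twice-floor≤ (k + m) q) (m≤m+n _ 0))

level₃-< : ∀ q .{{_ : NonZero q}} k m {o} → 2 ≤ q → q ∣ℕ o → suc o ≡ 2 * (k + m) →
  floorSum q (denArgs₃ k m) < floorSum q (numArgs₃ k m)
level₃-< q k m 2≤q q∣o 1+o≡2n = <-≤-trans (≤-<-trans (level₃-≤twice q k m) (twice-floor< 2≤q q∣o 1+o≡2n)) (m≤m+n _ 0)

prime-power≥4 : ∀ {p o n} i → Prime p → p ≢ 3 → suc o ≡ 2 * n → p ^ suc i ∣ℕ o → 4 ≤ p ^ suc i
prime-power≥4 {0}                       i () _ _ _
prime-power≥4 {1}                       i () _ _ _
prime-power≥4 {2}     {o} {n}           i _ _ 1+o≡2n 2^1+i∣o with ∣-trans (m∣m*n (2 ^ i)) 2^1+i∣o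
... | divides t o≡t·2 = ⊥-elim (even≢odd n t (trans (sym 1+o≡2n) (cong suc (trans o≡t·2 (*-comm t 2)))))
prime-power≥4 {3}                       i _ p≢3 _ _ = ⊥-elim (p≢3 refl)
prime-power≥4 {p@(suc (suc (suc (suc _))))} i _ _ _ _ = ≤-trans (s≤s (s≤s (s≤s (s≤s z≤n)))) (m≤m*n p (p ^ i) {{m^n≢0 p i}})

module MainInequality (k m o : ℕ) .{{o≢0 : NonZero o}} (1+o≡2n : suc o ≡ 2 * (k + m)) where

  private
    n : ℕ
    n = k + m
    Z : ℕ
    Z = 6 * n
    k≤n : k ≤ n
    k≤n = m≤m+n k m
    m≤n : m ≤ n
    m≤n = m≤n+m m k

    -- Every argument is at most 6n, which therefore bounds the number of relevant levels.
    ≤Z : ∀ {x} → x ≤ n → x ≤ Z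
    ≤Z x≤n = ≤-trans x≤n (m≤n*m n 6)
    2·≤Z : ∀ {x} → x ≤ n → 2 * x ≤ Z
    2·≤Z = *-mono-≤ (m≤m+n 2 4)
    3·≤Z : ∀ {x} → x ≤ n → 3 * x ≤ Z
    3·≤Z = *-mono-≤ (m≤m+n 3 3)
    6·≤Z : ∀ {x} → x ≤ n → 6 * x ≤ Z
    6·≤Z = *-mono-≤ (≤-refl {6})

    o≤Z : o ≤ Z
    o≤Z = ≤-trans (n≤1+n o) (subst (_≤ Z) (sym 1+o≡2n) (2·≤Z ≤-refl))
    den≤Z : All (_≤ Z) (denArgs k m)
    den≤Z = 3·≤Z ≤-refl ∷ 3·≤Z k≤n ∷ ≤Z k≤n ∷ 2·≤Z k≤n ∷ 3·≤Z m≤n ∷ ≤Z m≤n ∷ 2·≤Z m≤n ∷ []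
    num≤Z : All (_≤ Z) (numArgs k m)
    num≤Z = 6·≤Z k≤n ∷ 6·≤Z m≤n ∷ ≤Z ≤-refl ∷ 2·≤Z ≤-refl ∷ []
    den₃≤Z : All (_≤ Z) (denArgs₃ k m)
    den₃≤Z = ≤Z k≤n ∷ ≤Z k≤n ∷ ≤Z m≤n ∷ ≤Z m≤n ∷ []
    num₃≤Z : All (_≤ Z) (numArgs₃ k m)
    num₃≤Z = 2·≤Z ≤-refl ∷ []

  val-bound-≢3 : ∀ {p} (p-prime : Prime p) → p ≢ 3 →
    val p-prime (o * factorials (denArgs k m)) ≤ val p-prime (factorials (numArgs k m))
  val-bound-≢3 {p} p-prime p≢3 = Valuation.val-≤-by-levels p-prime Z o _ _ o≤Z den≤Z num≤Z λ i →
    let instance _ = m^n≢0 p (suc i) in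
    indicator-+-≤ (p ^ suc i ∣? o) (level-≤ (p ^ suc i) k m)
      (λ q∣o → level-< (p ^ suc i) k m (prime-power≥4 {n = n} i p-prime p≢3 1+o≡2n q∣o) q∣o 1+o≡2n)
    where
    instance
      p≢0 : NonZero p
      p≢0 = prime⇒nonZero p-prime

  -- For p = 3, cancelling ν₃((3N)!) = N + ν₃(N!) reduces the claim to ν₃((2n−1)·k!²·m!²) ≤ ν₃((2n)!).
  module _ (3-prime : Prime 3) where
    open Valuation 3-prime using (val-multiple!; val-factorials; val-≤-by-levels)

    private
      ν : ℕ → ℕ
      ν = val 3-prime
      ν! : ℕ → ℕ
      ν! x = ν (x !)
      -- the part shared by both valuations after cancelling ν₃((3N)!) = N + ν₃(N!)
      common : ℕ
      common = 2 * n + (ν! n + (ν! (2 * k) + ν! (2 * m)))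

      val-o·factorials : ∀ xs → ν (o * factorials xs) ≡ ν o + sum (map ν! xs)
      val-o·factorials xs = trans (val-* 3-prime o (factorials xs) {{o≢0}} {{factorials≢0 xs}}) (cong (ν o +_) (val-factorials xs))

    val₃-den : ν (o * factorials (denArgs k m)) ≡ ν (o * factorials (denArgs₃ k m)) + common
    val₃-den = begin
      ν (o * factorials (denArgs k m))
        ≡⟨ val-o·factorials (denArgs k m) ⟩
      ν o + (ν! (3 * n) + (ν! (3 * k) + (ν! k + (ν! (2 * k) + (ν! (3 * m) + (ν! m + (ν! (2 * m) + 0)))))))
        ≡⟨ cong (ν o +_) (cong₂ _+_ (val-multiple! n) (cong₂ _+_ (val-multiple! k)
             (cong (λ x → ν! k + (ν! (2 * k) + (x + (ν! m + (ν! (2 * m) + 0))))) (val-multiple! m)))) ⟩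
      ν o + ((n + ν! n) + ((k + ν! k) + (ν! k + (ν! (2 * k) + ((m + ν! m) + (ν! m + (ν! (2 * m) + 0)))))))
        ≡⟨ regroup (ν o) k m (ν! n) (ν! k) (ν! (2 * k)) (ν! m) (ν! (2 * m)) ⟩
      (ν o + (ν! k + (ν! k + (ν! m + (ν! m + 0))))) + common
        ≡⟨ cong (_+ common) (val-o·factorials (denArgs₃ k m)) ⟨
      ν (o * factorials (denArgs₃ k m)) + common ∎
      where
      open ≡-Reasoning
      regroup : ∀ νo k m νn νk ν2k νm ν2m →
        νo + (((k + m) + νn) + ((k + νk) + (νk + (ν2k + ((m + νm) + (νm + (ν2m + 0)))))))
        ≡ (νo + (νk + (νk + (νm + (νm + 0))))) + (2 * (k + m) + (νn + (ν2k + ν2m)))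
      regroup = solve-∀

    val₃-num : ν (factorials (numArgs k m)) ≡ ν (factorials (numArgs₃ k m)) + common
    val₃-num = begin
      ν (factorials (numArgs k m))
        ≡⟨ val-factorials (numArgs k m) ⟩
      ν! (6 * k) + (ν! (6 * m) + (ν! n + (ν! (2 * n) + 0)))
        ≡⟨ cong₂ _+_ (trans (cong ν! (*-assoc 3 2 k)) (val-multiple! (2 * k)))
                     (cong (_+ (ν! n + (ν! (2 * n) + 0))) (trans (cong ν! (*-assoc 3 2 m)) (val-multiple! (2 * m)))) ⟩
      (2 * k + ν! (2 * k)) + ((2 * m + ν! (2 * m)) + (ν! n + (ν! (2 * n) + 0)))
        ≡⟨ regroup k m (ν! n) (ν! (2 * k)) (ν! (2 * m)) (ν! (2 * n)) ⟩
      (ν! (2 * n) + 0) + common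
        ≡⟨ cong (_+ common) (val-factorials (numArgs₃ k m)) ⟨
      ν (factorials (numArgs₃ k m)) + common ∎
      where
      open ≡-Reasoning
      regroup : ∀ k m νn ν2k ν2m ν2n →
        (2 * k + ν2k) + ((2 * m + ν2m) + (νn + (ν2n + 0)))
        ≡ (ν2n + 0) + (2 * (k + m) + (νn + (ν2k + ν2m)))
      regroup = solve-∀

    val-bound-3 : ν (o * factorials (denArgs k m)) ≤ ν (factorials (numArgs k m))
    val-bound-3 = subst₂ _≤_ (sym val₃-den) (sym val₃-num) (+-monoˡ-≤ common
      (val-≤-by-levels Z o _ _ o≤Z den₃≤Z num₃≤Z λ i →
        let instance _ = m^n≢0 3 (suc i) in
        indicator-+-≤ (3 ^ suc i ∣? o) (level₃-≤ (3 ^ suc i) k m)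
          (λ q∣o → level₃-< (3 ^ suc i) k m (≤-trans (n≤1+n 2) (m≤m*n 3 (3 ^ i) {{m^n≢0 3 i}})) q∣o 1+o≡2n)))

  factorial-divisibility : o * factorials (denArgs k m) ∣ℕ factorials (numArgs k m)
  factorial-divisibility = ∣-from-valuations _ _ {{m*n≢0 o _ {{o≢0}} {{factorials≢0 (denArgs k m)}}}} {{factorials≢0 (numArgs k m)}} bound
    where
    bound : ∀ {p} (p-prime : Prime p) →
      val p-prime (o * factorials (denArgs k m)) ≤ val p-prime (factorials (numArgs k m))
    bound {p} p-prime with p ≟ 3
    ... | yes refl = val-bound-3 p-prime
    ... | no  p≢3  = val-bound-≢3 p-prime p≢3

binomial-factorials : ∀ N a b → N ≡ a + b → (N C a) * (a ! * b !) ≡ N !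
binomial-factorials N a b N≡a+b = begin
  (N C a) * (a ! * b !)       ≡⟨ cong (λ x → (N C a) * (a ! * x !)) b≡N∸a ⟩
  (N C a) * (a ! * (N ∸ a) !) ≡⟨ cong (_* (a ! * (N ∸ a) !)) (nCk≡n!/k![n-k]! a≤N) ⟩
  N ! / (a ! * (N ∸ a) !) * (a ! * (N ∸ a) !) ≡⟨ m/n*n≡m (k![n∸k]!∣n! a≤N) ⟩
  N !                         ∎
  where
  open ≡-Reasoning
  a≤N : a ≤ N
  a≤N = subst (a ≤_) (sym N≡a+b) (m≤m+n a b)
  b≡N∸a : b ≡ N ∸ a
  b≡N∸a = sym (trans (cong (_∸ a) N≡a+b) (m+n∸m≡n a b))
  instance
    a!·[N∸a]!≢0 : NonZero (a ! * (N ∸ a) !)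
    a!·[N∸a]!≢0 = a !* (N ∸ a) !≢0

3N≡N+2N : ∀ N → 3 * N ≡ N + 2 * N
3N≡N+2N = solve-∀

two-binomials : ∀ N → ((6 * N) C (3 * N)) * (((3 * N) C N) * ((3 * N) ! * (N ! * (2 * N) !))) ≡ (6 * N) !
two-binomials N = begin
  c₁ * (c₂ * ((3 * N) ! * (N ! * (2 * N) !)))  ≡⟨ cong (c₁ *_) (*-left-comm c₂ ((3 * N) !) (N ! * (2 * N) !)) ⟩
  c₁ * ((3 * N) ! * (c₂ * (N ! * (2 * N) !)))  ≡⟨ cong (λ x → c₁ * ((3 * N) ! * x)) (binomial-factorials (3 * N) N (2 * N) (3N≡N+2N N)) ⟩
  c₁ * ((3 * N) ! * (3 * N) !)                ≡⟨ binomial-factorials (6 * N) (3 * N) (3 * N) (*-distribʳ-+ N 3 3) ⟩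
  (6 * N) !                                    ∎
  where
  open ≡-Reasoning
  c₁ c₂ : ℕ
  c₁ = (6 * N) C (3 * N)
  c₂ = (3 * N) C N

-- The theorem over ℕ, with m = n − k and o = 2n − 1: multiplying both sides by
-- P = n!·(2n)!·(3k)!·k!·(2k)!·(3m)!·m!·(2m)! turns it into factorial-divisibility.
binomial-divisibility : ∀ k m o .{{_ : NonZero o}} → suc o ≡ 2 * (k + m) →
  o * ((3 * (k + m)) C (k + m)) ∣ℕ ((6 * k) C (3 * k)) * ((3 * k) C k) * ((6 * m) C (3 * m)) * ((3 * m) C m)
binomial-divisibility k m o 1+o≡2n =
  *-cancelʳ-∣ P {{P≢0}} (subst₂ _∣ℕ_ (sym den≡) (sym num≡) (MainInequality.factorial-divisibility k m o 1+o≡2n))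
  where
  n E D P : ℕ
  n = k + m
  E = n ! * (2 * n) !
  rest : List ℕ
  rest = 3 * k ∷ k ∷ 2 * k ∷ 3 * m ∷ m ∷ 2 * m ∷ []
  D = factorials rest
  P = E * D
  P≢0 : NonZero P
  P≢0 = m*n≢0 E D {{n !* (2 * n) !≢0}} {{factorials≢0 rest}}
  c : ℕ
  c = (3 * n) C n
  den≡ : o * c * P ≡ o * factorials (denArgs k m)
  den≡ = begin
    o * c * (E * D)     ≡⟨ *-assoc o c (E * D) ⟩
    o * (c * (E * D))   ≡⟨ cong (o *_) (*-assoc c E D) ⟨
    o * (c * E * D)     ≡⟨ cong (λ x → o * (x * D)) (binomial-factorials (3 * n) n (2 * n) (3N≡N+2N n)) ⟩
    o * ((3 * n) ! * D) ∎
    where open ≡-Reasoning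
  num≡ : ((6 * k) C (3 * k)) * ((3 * k) C k) * ((6 * m) C (3 * m)) * ((3 * m) C m) * P ≡ factorials (numArgs k m)
  num≡ = trans (regroup ((6 * k) C (3 * k)) ((3 * k) C k) ((6 * m) C (3 * m)) ((3 * m) C m) (n !) ((2 * n) !)
                          ((3 * k) !) (k !) ((2 * k) !) ((3 * m) !) (m !) ((2 * m) !))
                 (cong₂ (λ x y → x * (y * (n ! * ((2 * n) ! * 1)))) (two-binomials k) (two-binomials m))
    where
    regroup : ∀ c₁ c₂ c₃ c₄ fn f2n f3k fk f2k f3m fm f2m →
      c₁ * c₂ * c₃ * c₄ * ((fn * f2n) * (f3k * (fk * (f2k * (f3m * (fm * (f2m * 1)))))))
      ≡ (c₁ * (c₂ * (f3k * (fk * f2k)))) * ((c₃ * (c₄ * (f3m * (fm * f2m)))) * (fn * (f2n * 1)))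
    regroup = solve-∀

-- The statement lives in ℤ, where m ∣ n means ∣m∣ divides ∣n∣ in ℕ.  For n = 0 the divisor is −1.
open import Data.Integer using (+_; _-_)
open import Data.Integer.Divisibility using (_∣_)
open import Data.Integer.Properties using (abs-*)

theorem1 : (n k : ℕ) → k ≤ n →
    ((+ (2 * n) - + 1) Data.Integer.* (+ ((3 * n) C n))) ∣
      (+ (((6 * k) C (3 * k)) * ((3 * k) C k) * ((6 * (n ∸ k)) C (3 * (n ∸ k))) * ((3 * (n ∸ k)) C (n ∸ k))))
theorem1 zero    k _   = 1∣ _
theorem1 (suc n) k k≤n =
  subst (_∣ℕ numerator) (sym (abs-* (+ (2 * suc n) - + 1) (+ ((3 * suc n) C suc n))))
    (subst (λ N → o * ((3 * N) C N) ∣ℕ numerator) k+m≡n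
      (binomial-divisibility k m o {{o≢0}} (cong (2 *_) (sym k+m≡n))))
  where
  m : ℕ
  m = suc n ∸ k
  k+m≡n : k + m ≡ suc n
  k+m≡n = m+[n∸m]≡n k≤n
  numerator : ℕ
  numerator = ((6 * k) C (3 * k)) * ((3 * k) C k) * ((6 * m) C (3 * m)) * ((3 * m) C m)
  o : ℕ
  o = 2 * suc n ∸ 1
  o≢0 : NonZero o
  o≢0 = ≢-nonZero (λ o≡0 → 0≢1+n (trans (sym o≡0) (+-suc n (n + 0))))
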